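{- Let $P$ be a pattern of length $m$, let $\mathcal S$ be a set of searches with $p$ parts, let $N=\lceil\log_\sigma n\rceil+c_\sigma$, and assume $m<pN$. Let $Y$ be a bounded partition of a prefix $P'=P[1..m']$ of $P$ with $m'\ge N$, and let $S\in\mathcal S(Y)$. Then the value $\mathit{strings}'(S,X,\sigma,n)$ is the same for every bounded partition $X$ of $P$ into $p$ parts whose first $|Y|$ parts coincide with the parts of $Y$.
   Context: A search with $p$ parts is a triple $S=(\pi,L,U)$ where $\pi$ is a permutation of $\{1,\dots,p\}$ written as a string and satisfying: for every $i>1$, $\pi(i)$ equals $\min_{j<i}\pi(j)-1$ or $\max_{j<i}\pi(j)+1$; and $L,U$ are strings of length $p$ over $\{0,\dots,k\}$. A partition $X$ of a pattern $P$ of length $m$ into $p$ parts is a sequence of positive part lengths $X[1],\dots,X[p]$ summing to $m$ (the $j$-th part being the $j$-th consecutive block of $P$); partitions of a substring of $P$ are defined analogously. Fix integers $\sigma\ge2$, $n\ge1$, and a fixed nonnegative integer constant $c_\sigma$; $N=\lceil\log_\sigma n\rceil+c_\sigma$. A partition is bounded if each of its parts has length at most $N$. For a search $S$ and partition $X$ of $P$, let $\pi_X$, $L_X$, $U_X$ be the strings of length $m$ obtained from $\pi$, $L$, $U$ by replacing, for each $i$, the $i$-th character by a run of that character of length $X[\pi(i)]$. Define $n_{0,0}=1$, $n_{0,d}=0$ for $d\ne0$, and for $l\ge1$: $n_{l,d}=n_{l-1,d}+(\sigma-1)n_{l-1,d-1}$ if $L_X[l]\le d\le U_X[l]$, and $n_{l,d}=0$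 otherwise; let $\mathcal N_l=\sum_{d=L_X[l]}^{U_X[l]}n_{l,d}$. Then $\mathit{strings}'(S,X,\sigma,n)=\sum_{l=1}^{N}\mathcal N_l\,(1-e^{ -n/\sigma^l})$. For a partition $Y$ of a prefix $P[1..m']$: $|Y|$ is its number of parts, and $\mathrm{rank}(Y)$ is the left-to-right index of the part of $Y$ containing position $m'-N+1$. The set $\mathcal S(Y)$ is: $\emptyset$ if $m'<N$; $\mathcal S$ if $m'=m$; and otherwise the set of searches $S=(\pi,L,U)\in\mathcal S$ such that $\mathrm{rank}(Y)$ appears before $|Y|+1$ in the string $\pi$. -}

module Defs where

open import Level using (Level)
open import Data.Nat using (ℕ; zero; suc; _+_; _*_; _∸_; _^_; _≤_; _<_; _≤ᵇ_; _≡ᵇ_)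
open import Data.Bool using (Bool; true; false; if_then_else_; _∧_)
open import Data.Nat.ListAction using (sum)
open import Data.List using (List; []; _∷_; length; map; upTo; replicate; concat; zipWith; take)
open import Data.List.Relation.Unary.All using (All)
open import Data.List.Relation.Unary.Unique.Propositional using (Unique)
open import Data.Product using (Σ; ∃; _×_; _,_)
open import Data.Sum using (_⊎_)
open import Data.Empty using (⊥)
open import Relation.Binary.PropositionalEquality using (_≡_)
open import Algebra.Bundles using (CommutativeSemiring)

-- 1-based lookup in a list of naturals; returns 0 out of range
-- (index 0 or index > length).
at : List ℕ → ℕ → ℕ
at [] _ = 0
at (x ∷ xs) zero = 0
at (x ∷ xs) (suc zero) = x
at (x ∷ xs) (suc (suc i)) = at xs (suc i)

-- sum_{d=a}^{b} f d   (empty if b < a)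
sumRange : ℕ → ℕ → (ℕ → ℕ) → ℕ
sumRange a b f = sum (map (λ i → f (a + i)) (upTo (suc b ∸ a)))

-- minimum / maximum of a list of naturals (default 0 for [])
minL : List ℕ → ℕ
minL [] = 0
minL (x ∷ []) = x
minL (x ∷ y ∷ ys) = Data.Nat._⊓_ x (minL (y ∷ ys))

maxL : List ℕ → ℕ
maxL [] = 0
maxL (x ∷ xs) = Data.Nat._⊔_ x (maxL xs)

-- ceiling logarithm: least t with n ≤ σ^t (searching t = 0,1,..., with
-- fuel; for σ ≥ 2, n ≥ 1 the answer is ≤ n so fuel n suffices)
clogFrom : (σ n fuel t : ℕ) → ℕ
clogFrom σ n zero t = t
clogFrom σ n (suc fuel) t = if n ≤ᵇ (σ ^ t) then t else clogFrom σ n fuel (suc t)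

⌈log_⌉ : ℕ → ℕ → ℕ
⌈log_⌉ σ n = clogFrom σ n n 0

bigN : (σ n cσ : ℕ) → ℕ
bigN σ n cσ = ⌈log_⌉ σ n + cσ

Connected : List ℕ → Set
Connected π = ∀ i → 2 ≤ i → i ≤ length π →
  (suc (at π i) ≡ minL (take (i ∸ 1) π)) ⊎ (at π i ≡ suc (maxL (take (i ∸ 1) π)))

IsPermutation : ℕ → List ℕ → Set
IsPermutation p π = length π ≡ p × Unique π × All (λ x → 1 ≤ x × x ≤ p) π

record Search (p k : ℕ) : Set where
  field
    π L U   : List ℕ
    π-perm  : IsPermutation p π
    π-conn  : Connected π
    L-len   : length L ≡ p
    U-len   : length U ≡ p
    L-bound : All (_≤ k) L
    U-bound : All (_≤ k) U
open Search public

IsPartition : ℕ → List ℕ → Set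
IsPartition len X = All (1 ≤_) X × sum X ≡ len

Bounded : ℕ → List ℕ → Set
Bounded N X = All (_≤ N) X

-- π_X, L_X, U_X : strings of length m

expand : List ℕ → List ℕ → List ℕ → List ℕ
expand X π s = concat (zipWith (λ q c → replicate (at X q) c) π s)

module _ (σ : ℕ) (LX UX : List ℕ) where
  -- n_{l,d} (d ranges over ℕ: all values at negative d are 0)
  nld : ℕ → ℕ → ℕ
  nld zero zero = 1
  nld zero (suc d) = 0
  nld (suc l) d =
    if (at LX (suc l) ≤ᵇ d) ∧ (d ≤ᵇ at UX (suc l))
    then nld l d + (σ ∸ 1) * prev d
    else 0
    where
      prev : ℕ → ℕ
      prev zero = 0
      prev (suc d') = nld l d'

  𝒩 : ℕ → ℕ
  𝒩 l = sumRange (at LX l) (at UX l) (nld l)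

-- strings'(S,X,σ,n) = Σ_{l=1}^{N} 𝒩_l (1 - e^{-n/σ^l}),
-- generalised to an arbitrary weight w l in place of (1 - e^{-n/σ^l})
-- with values in an arbitrary commutative semiring.

module _ {a ℓ : Level} (R : CommutativeSemiring a ℓ) where
  open CommutativeSemiring R using () renaming (Carrier to A; _+_ to _⊕_; 0# to 𝟘)

  scale : ℕ → A → A
  scale zero x = 𝟘
  scale (suc k) x = x ⊕ scale k x

  sumR : List A → A
  sumR [] = 𝟘
  sumR (x ∷ xs) = x ⊕ sumR xs

  strings′ : (w : ℕ → A) {p k : ℕ} → Search p k → (X : List ℕ) (σ N : ℕ) → A
  strings′ w S X σ N =
    sumR (map (λ i → scale (𝒩 σ (expand X (π S) (L S)) (expand X (π S) (U S)) (suc i))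
                           (w (suc i)))
              (upTo N))

rankAt : List ℕ → ℕ → ℕ
rankAt [] pos = 0
rankAt (y ∷ ys) pos = if pos ≤ᵇ y then 1 else suc (rankAt ys (pos ∸ y))

rank : (N m' : ℕ) → List ℕ → ℕ
rank N m' Y = rankAt Y (suc (m' ∸ N))

AppearsBefore : ℕ → ℕ → List ℕ → Set
AppearsBefore a b π =
  Σ ℕ λ i → Σ ℕ λ j → i < j × j ≤ length π × 1 ≤ i × at π i ≡ a × at π j ≡ b

InSY : {p k : ℕ} (𝒮 : Search p k → Set) (N m m' : ℕ) (Y : List ℕ) → Search p k → Set
InSY 𝒮 N m m' Y S with m' <ᵇ' N
  where _<ᵇ'_ : ℕ → ℕ → Bool
        x <ᵇ' y = suc x ≤ᵇ y
... | true = ⊥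
... | false with m' ≡ᵇ m
...   | true = 𝒮 S
...   | false = 𝒮 S × AppearsBefore (rank N m' Y) (suc (length Y)) (π S)

module Submission where

-- strings′ reads only the first N characters of L_X and U_X.  If m' = m then X = Y = X′.
-- Otherwise let ρ be the prefix of π in front of |Y|+1.  By connectivity every nonempty prefix
-- of π enumerates an interval of part indices; ρ contains rank(Y) ≤ |Y| and is followed by
-- |Y|+1, so ρ is an interval [a, |Y|] with a ≤ rank(Y).  Thus ρ uses only parts of Y, which
-- X and X′ share, among them the parts rank(Y), …, |Y| covering the last N positions of
-- P[1..m'].  So the runs of ρ already fill the first N characters, identically for X and X′.

open import Defs
open import Level using (Level)
open import Data.Nat using (ℕ; zero; suc; _+_; _*_; _∸_; _≤_; _<_; _≤ᵇ_; _≡ᵇ_; z≤n; s≤s; _⊓_; _⊔_)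
open import Data.Nat.Properties
open import Data.Nat.ListAction using (sum)
open import Data.Nat.ListAction.Properties using (sum-++)
open import Data.Bool using (true; false; T; if_then_else_; _∧_)
open import Data.Unit using (tt)
open import Data.Empty using (⊥-elim)
open import Data.Product using (Σ; _×_; _,_; proj₁; proj₂)
open import Data.Sum using (_⊎_; inj₁; inj₂)
open import Data.List using (List; []; _∷_; [_]; length; take; drop; map; upTo; replicate; _++_)
open import Data.List.Properties using (map-cong; map-cong-local; map-++; length-take; take++drop≡id; ++-identityʳ)
open import Data.List.Relation.Unary.All as All using (All; []; _∷_)
open import Data.List.Relation.Unary.All.Properties using (all-upTo; drop⁺)
open import Relation.Binary.PropositionalEquality using (_≡_; refl; sym; trans; cong; cong₂; subst; module ≡-Reasoning)
open import Algebra.Bundles using (CommutativeSemiring)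

at-take : ∀ n xs {l} → l ≤ n → at (take n xs) l ≡ at xs l
at-take zero    []       {zero}        _         = refl
at-take zero    (x ∷ xs) {zero}        _         = refl
at-take (suc n) []       {l}           _         = refl
at-take (suc n) (x ∷ xs) {zero}        _         = refl
at-take (suc n) (x ∷ xs) {suc zero}    _         = refl
at-take (suc n) (x ∷ xs) {suc (suc l)} (s≤s l≤n) = at-take n xs l≤n

take-≡⇒at-≡ : ∀ n {xs ys} → take n xs ≡ take n ys → ∀ {l} → l ≤ n → at xs l ≡ at ys l
take-≡⇒at-≡ n {xs} {ys} eq {l} l≤n =
  trans (sym (at-take n xs l≤n)) (trans (cong (λ zs → at zs l) eq) (at-take n ys l≤n))

sumRange-cong : ∀ a b {f g : ℕ → ℕ} → (∀ d → f d ≡ g d) → sumRange a b f ≡ sumRange a b g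
sumRange-cong a b f≗g = cong sum (map-cong (λ i → f≗g (a + i)) (upTo (suc b ∸ a)))

module _ (σ N : ℕ) {LX UX LX′ UX′ : List ℕ}
         (L≡ : take N LX ≡ take N LX′) (U≡ : take N UX ≡ take N UX′) where

  private
    guard-cong : ∀ {l} → l ≤ N → ∀ d →
                 ((at LX l ≤ᵇ d) ∧ (d ≤ᵇ at UX l)) ≡ ((at LX′ l ≤ᵇ d) ∧ (d ≤ᵇ at UX′ l))
    guard-cong l≤N d =
      cong₂ (λ a b → (a ≤ᵇ d) ∧ (d ≤ᵇ b)) (take-≡⇒at-≡ N L≡ l≤N) (take-≡⇒at-≡ N U≡ l≤N)

  nld-cong : ∀ l → l ≤ N → ∀ d → nld σ LX UX l d ≡ nld σ LX′ UX′ l d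
  nld-cong zero    _   zero    = refl
  nld-cong zero    _   (suc d) = refl
  nld-cong (suc l) l<N zero    =
    cong₂ (λ b x → if b then x else 0) (guard-cong l<N zero)
          (cong (λ x → x + (σ ∸ 1) * 0) (nld-cong l (<⇒≤ l<N) zero))
  nld-cong (suc l) l<N (suc d) =
    cong₂ (λ b x → if b then x else 0) (guard-cong l<N (suc d))
          (cong₂ (λ x y → x + (σ ∸ 1) * y) (nld-cong l (<⇒≤ l<N) (suc d)) (nld-cong l (<⇒≤ l<N) d))

  𝒩-cong : ∀ {l} → l ≤ N → 𝒩 σ LX UX l ≡ 𝒩 σ LX′ UX′ l
  𝒩-cong {l} l≤N =
    trans (cong₂ (λ a b → sumRange a b (nld σ LX UX l)) (take-≡⇒at-≡ N L≡ l≤N) (take-≡⇒at-≡ N U≡ l≤N))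
          (sumRange-cong (at LX′ l) (at UX′ l) (nld-cong l l≤N))

strings′-cong : ∀ {a ℓ} (R : CommutativeSemiring a ℓ) w {p k} (S : Search p k) X X′ σ N →
                take N (expand X (π S) (L S)) ≡ take N (expand X′ (π S) (L S)) →
                take N (expand X (π S) (U S)) ≡ take N (expand X′ (π S) (U S)) →
                strings′ R w S X σ N ≡ strings′ R w S X′ σ N
strings′-cong R w S X X′ σ N L≡ U≡ =
  cong (sumR R) (map-cong-local (All.map (λ {i} i<N → cong (λ c → scale R c (w (suc i))) (𝒩-cong σ N L≡ U≡ i<N))
                                         (all-upTo N)))

take-replicate-++ : ∀ {a} {A : Set a} n a (c : A) {ys zs : List A} → take (n ∸ a) ys ≡ take (n ∸ a) zs →
                    take n (replicate a c ++ ys) ≡ take n (replicate a c ++ zs)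
take-replicate-++ n       zero    c eq = eq
take-replicate-++ zero    (suc a) c eq = refl
take-replicate-++ (suc n) (suc a) c eq = cong (c ∷_) (take-replicate-++ n a c eq)

take-expand-++-cong : ∀ X X′ ρ τ s n → All (λ q → at X q ≡ at X′ q) ρ → n ≤ sum (map (at X) ρ) →
                      length ρ ≤ length s → take n (expand X (ρ ++ τ) s) ≡ take n (expand X′ (ρ ++ τ) s)
take-expand-++-cong X X′ []      τ s       zero [] z≤n _ = refl
take-expand-++-cong X X′ (q ∷ ρ) τ (c ∷ s) n (Xq≡X′q ∷ agree) n≤ (s≤s |ρ|≤|s|) =
  trans (take-replicate-++ n (at X q) c
           (take-expand-++-cong X X′ ρ τ s (n ∸ at X q) agree (m≤n+o⇒m∸n≤o n (at X q) n≤) |ρ|≤|s|))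
        (cong (λ a → take n (replicate a c ++ expand X′ (ρ ++ τ) s)) Xq≡X′q)

sumFrom : (ℕ → ℕ) → ℕ → ℕ → ℕ
sumFrom f a zero    = 0
sumFrom f a (suc l) = f a + sumFrom f (suc a) l

sumFrom-suc : ∀ f a l → sumFrom f a (suc l) ≡ sumFrom f a l + f (a + l)
sumFrom-suc f a zero    = trans (+-comm (f a) 0) (cong f (sym (+-identityʳ a)))
sumFrom-suc f a (suc l) = begin
  f a + sumFrom f (suc a) (suc l)             ≡⟨ cong (f a +_) (sumFrom-suc f (suc a) l) ⟩
  f a + (sumFrom f (suc a) l + f (suc a + l)) ≡⟨ sym (+-assoc (f a) _ _) ⟩
  f a + sumFrom f (suc a) l + f (suc a + l)   ≡⟨ cong (λ b → f a + sumFrom f (suc a) l + f b) (sym (+-suc a l)) ⟩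
  f a + sumFrom f (suc a) l + f (a + suc l)   ∎
  where open ≡-Reasoning

sumFrom-suffix-≤ : ∀ f a d e → sumFrom f (a + d) e ≤ sumFrom f a (d + e)
sumFrom-suffix-≤ f a zero    e = ≤-reflexive (cong (λ b → sumFrom f b e) (+-identityʳ a))
sumFrom-suffix-≤ f a (suc d) e = begin
  sumFrom f (a + suc d) e      ≡⟨ cong (λ b → sumFrom f b e) (+-suc a d) ⟩
  sumFrom f (suc a + d) e      ≤⟨ sumFrom-suffix-≤ f (suc a) d e ⟩
  sumFrom f (suc a) (d + e)    ≤⟨ m≤n+m _ (f a) ⟩
  f a + sumFrom f (suc a) (d + e) ∎
  where open ≤-Reasoning

sumFrom-at-∷ : ∀ y ys i l → sumFrom (at (y ∷ ys)) (suc (suc i)) l ≡ sumFrom (at ys) (suc i) l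
sumFrom-at-∷ y ys i zero    = refl
sumFrom-at-∷ y ys i (suc l) = cong (at ys (suc i) +_) (sumFrom-at-∷ y ys (suc i) l)

sumFrom-at≡sum-drop : ∀ Y i → sumFrom (at Y) (suc i) (length Y ∸ i) ≡ sum (drop i Y)
sumFrom-at≡sum-drop []       zero    = refl
sumFrom-at≡sum-drop []       (suc i) = refl
sumFrom-at≡sum-drop (y ∷ ys) zero    =
  cong (y +_) (trans (sumFrom-at-∷ y ys 0 (length ys)) (sumFrom-at≡sum-drop ys 0))
sumFrom-at≡sum-drop (y ∷ ys) (suc i) =
  trans (sumFrom-at-∷ y ys i (length ys ∸ i)) (sumFrom-at≡sum-drop ys i)

minL-∷ʳ : ∀ y ys x → minL ((y ∷ ys) ++ [ x ]) ≡ minL (y ∷ ys) ⊓ x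
minL-∷ʳ y []       x = refl
minL-∷ʳ y (z ∷ zs) x = trans (cong (y ⊓_) (minL-∷ʳ z zs x)) (sym (⊓-assoc y _ x))

maxL-∷ʳ : ∀ ys x → maxL (ys ++ [ x ]) ≡ maxL ys ⊔ x
maxL-∷ʳ []       x = ⊔-identityʳ x
maxL-∷ʳ (z ∷ zs) x = trans (cong (z ⊔_) (maxL-∷ʳ zs x)) (sym (⊔-assoc z _ x))

minL≤maxL : ∀ y ys → minL (y ∷ ys) ≤ maxL (y ∷ ys)
minL≤maxL y []       = m≤m⊔n y 0
minL≤maxL y (z ∷ zs) = ≤-trans (m⊓n≤m y _) (m≤m⊔n y _)

minL≤at : ∀ xs {i} → 1 ≤ i → i ≤ length xs → minL xs ≤ at xs i
minL≤at (x ∷ [])     {suc zero}    _ _         = ≤-refl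
minL≤at (x ∷ [])     {suc (suc i)} _ (s≤s ())
minL≤at (x ∷ y ∷ ys) {suc zero}    _ _         = m⊓n≤m x _
minL≤at (x ∷ y ∷ ys) {suc (suc i)} _ (s≤s i≤n) = ≤-trans (m⊓n≤n x _) (minL≤at (y ∷ ys) (s≤s z≤n) i≤n)

all≤maxL : ∀ xs → All (_≤ maxL xs) xs
all≤maxL []       = []
all≤maxL (x ∷ xs) = m≤m⊔n x _ ∷ All.map (λ le → ≤-trans le (m≤n⊔m x _)) (all≤maxL xs)

take-suc-at : ∀ t (xs : List ℕ) → suc t ≤ length xs → take (suc t) xs ≡ take t xs ++ [ at xs (suc t) ]
take-suc-at zero    (x ∷ xs) _         = refl
take-suc-at (suc t) (x ∷ xs) (s≤s t<n) = cong (x ∷_) (take-suc-at t xs t<n)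

sum-map-∷ʳ : ∀ (f : ℕ → ℕ) ρ x → sum (map f (ρ ++ [ x ])) ≡ sum (map f ρ) + f x
sum-map-∷ʳ f ρ x = trans (cong sum (map-++ f ρ [ x ]))
                         (trans (sum-++ (map f ρ) [ f x ]) (cong (sum (map f ρ) +_) (+-identityʳ (f x))))

-- As multisets ρ = {minL ρ, …, maxL ρ}; equality of multisets is expressed by equality of all weighted sums.
IsInterval : List ℕ → Set
IsInterval ρ = Σ ℕ λ l → minL ρ + l ≡ suc (maxL ρ) × (∀ f → sum (map f ρ) ≡ sumFrom f (minL ρ) l)

isInterval-∷ʳ : ∀ y ys x → IsInterval (y ∷ ys) →
                (suc x ≡ minL (y ∷ ys)) ⊎ (x ≡ suc (maxL (y ∷ ys))) → IsInterval ((y ∷ ys) ++ [ x ])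
isInterval-∷ʳ y ys x (l , a+l≡1+b , sums) (inj₁ 1+x≡a) = suc l , length≡ , sums′
  where
    ρ = y ∷ ys
    x≤b : x ≤ maxL ρ
    x≤b = ≤-trans (n≤1+n x) (≤-trans (≤-reflexive 1+x≡a) (minL≤maxL y ys))
    min≡x : minL (ρ ++ [ x ]) ≡ x
    min≡x = trans (minL-∷ʳ y ys x) (m≥n⇒m⊓n≡n (≤-trans (n≤1+n x) (≤-reflexive 1+x≡a)))
    max≡b : maxL (ρ ++ [ x ]) ≡ maxL ρ
    max≡b = trans (maxL-∷ʳ ρ x) (m≥n⇒m⊔n≡m x≤b)
    length≡ : minL (ρ ++ [ x ]) + suc l ≡ suc (maxL (ρ ++ [ x ]))
    length≡ = begin
      minL (ρ ++ [ x ]) + suc l ≡⟨ cong (_+ suc l) min≡x ⟩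
      x + suc l                 ≡⟨ +-suc x l ⟩
      suc x + l                 ≡⟨ cong (_+ l) 1+x≡a ⟩
      minL ρ + l                ≡⟨ a+l≡1+b ⟩
      suc (maxL ρ)              ≡⟨ cong suc (sym max≡b) ⟩
      suc (maxL (ρ ++ [ x ]))   ∎
      where open ≡-Reasoning
    sums′ : ∀ f → sum (map f (ρ ++ [ x ])) ≡ sumFrom f (minL (ρ ++ [ x ])) (suc l)
    sums′ f = begin
      sum (map f (ρ ++ [ x ]))        ≡⟨ sum-map-∷ʳ f ρ x ⟩
      sum (map f ρ) + f x             ≡⟨ cong (_+ f x) (sums f) ⟩
      sumFrom f (minL ρ) l + f x      ≡⟨ +-comm _ (f x) ⟩
      f x + sumFrom f (minL ρ) l      ≡⟨ cong (λ a → f x + sumFrom f a l) (sym 1+x≡a) ⟩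
      sumFrom f x (suc l)             ≡⟨ cong (λ a → sumFrom f a (suc l)) (sym min≡x) ⟩
      sumFrom f (minL (ρ ++ [ x ])) (suc l) ∎
      where open ≡-Reasoning
isInterval-∷ʳ y ys x (l , a+l≡1+b , sums) (inj₂ x≡1+b) = suc l , length≡ , sums′
  where
    ρ = y ∷ ys
    b≤x : maxL ρ ≤ x
    b≤x = ≤-trans (n≤1+n _) (≤-reflexive (sym x≡1+b))
    min≡a : minL (ρ ++ [ x ]) ≡ minL ρ
    min≡a = trans (minL-∷ʳ y ys x) (m≤n⇒m⊓n≡m (≤-trans (minL≤maxL y ys) b≤x))
    max≡x : maxL (ρ ++ [ x ]) ≡ x
    max≡x = trans (maxL-∷ʳ ρ x) (m≤n⇒m⊔n≡n b≤x)
    a+l≡x : minL ρ + l ≡ x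
    a+l≡x = trans a+l≡1+b (sym x≡1+b)
    length≡ : minL (ρ ++ [ x ]) + suc l ≡ suc (maxL (ρ ++ [ x ]))
    length≡ = begin
      minL (ρ ++ [ x ]) + suc l ≡⟨ cong (_+ suc l) min≡a ⟩
      minL ρ + suc l            ≡⟨ +-suc (minL ρ) l ⟩
      suc (minL ρ + l)          ≡⟨ cong suc a+l≡x ⟩
      suc x                     ≡⟨ cong suc (sym max≡x) ⟩
      suc (maxL (ρ ++ [ x ]))   ∎
      where open ≡-Reasoning
    sums′ : ∀ f → sum (map f (ρ ++ [ x ])) ≡ sumFrom f (minL (ρ ++ [ x ])) (suc l)
    sums′ f = begin
      sum (map f (ρ ++ [ x ]))              ≡⟨ sum-map-∷ʳ f ρ x ⟩
      sum (map f ρ) + f x                   ≡⟨ cong₂ _+_ (sums f) (cong f (sym a+l≡x)) ⟩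
      sumFrom f (minL ρ) l + f (minL ρ + l) ≡⟨ sym (sumFrom-suc f (minL ρ) l) ⟩
      sumFrom f (minL ρ) (suc l)            ≡⟨ cong (λ a → sumFrom f a (suc l)) (sym min≡a) ⟩
      sumFrom f (minL (ρ ++ [ x ])) (suc l) ∎
      where open ≡-Reasoning

take-isInterval : ∀ π → Connected π → ∀ t → 1 ≤ t → t ≤ length π → IsInterval (take t π)
take-isInterval (x ∷ π) conn (suc zero) _ _ = 1 , trans (+-comm x 1) (cong suc (sym (⊔-identityʳ x))) , λ f → refl
take-isInterval (x ∷ π) conn (suc (suc t)) _ t<n =
  subst IsInterval (sym (take-suc-at (suc t) (x ∷ π) t<n))
    (isInterval-∷ʳ x (take t π) (at (x ∷ π) (suc (suc t)))
      (take-isInterval (x ∷ π) conn (suc t) (s≤s z≤n) (<⇒≤ t<n))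
      (conn (suc (suc t)) (s≤s (s≤s z≤n)) t<n))

prefix-before-suc-covers : ∀ π r k → Connected π → r ≤ k → AppearsBefore r (suc k) π →
                           Σ ℕ λ t → All (_≤ k) (take t π) × (∀ f → sumFrom f r (suc k ∸ r) ≤ sum (map f (take t π)))
prefix-before-suc-covers π r k conn r≤k (i , suc t , i<j , j≤n , 1≤i , πi≡r , πj≡1+k) = t , all≤k , covers
  where
    ρ = take t π
    i≤t : i ≤ t
    i≤t = ≤-pred i<j
    1≤t : 1 ≤ t
    1≤t = ≤-trans 1≤i i≤t
    t≤n : t ≤ length π
    t≤n = <⇒≤ j≤n
    a = minL ρ
    a≤r : a ≤ r
    a≤r = subst (a ≤_) (trans (at-take t π i≤t) πi≡r)
            (minL≤at ρ 1≤i (subst (i ≤_) (sym (trans (length-take t π) (m≤n⇒m⊓n≡m t≤n))) i≤t))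
    max≡k : maxL ρ ≡ k
    max≡k with conn (suc t) (s≤s 1≤t) j≤n
    -- k + 1 cannot be minL ρ − 1, as minL ρ ≤ r ≤ k.
    ... | inj₁ 1+πj≡a = ⊥-elim (1+n≰n (≤-trans (≤-trans (n≤1+n (suc k)) (≤-reflexive (trans (cong suc (sym πj≡1+k)) 1+πj≡a)))
                                               (≤-trans a≤r r≤k)))
    ... | inj₂ πj≡1+b = suc-injective (trans (sym πj≡1+b) πj≡1+k)
    all≤k : All (_≤ k) ρ
    all≤k = subst (λ b → All (_≤ b) ρ) max≡k (all≤maxL ρ)
    interval : IsInterval ρ
    interval = take-isInterval π conn t 1≤t t≤n
    l : ℕ
    l = proj₁ interval
    l≡ : (r ∸ a) + (suc k ∸ r) ≡ l
    l≡ = +-cancelˡ-≡ a _ l (begin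
      a + ((r ∸ a) + (suc k ∸ r)) ≡⟨ sym (+-assoc a _ _) ⟩
      a + (r ∸ a) + (suc k ∸ r)   ≡⟨ cong (_+ (suc k ∸ r)) (m+[n∸m]≡n a≤r) ⟩
      r + (suc k ∸ r)             ≡⟨ m+[n∸m]≡n (≤-trans r≤k (n≤1+n k)) ⟩
      suc k                       ≡⟨ cong suc (sym max≡k) ⟩
      suc (maxL ρ)                ≡⟨ sym (proj₁ (proj₂ interval)) ⟩
      a + l                       ∎)
      where open ≡-Reasoning
    covers : ∀ f → sumFrom f r (suc k ∸ r) ≤ sum (map f ρ)
    covers f = begin
      sumFrom f r (suc k ∸ r)             ≡⟨ cong (λ b → sumFrom f b (suc k ∸ r)) (sym (m+[n∸m]≡n a≤r)) ⟩
      sumFrom f (a + (r ∸ a)) (suc k ∸ r) ≤⟨ sumFrom-suffix-≤ f a (r ∸ a) (suc k ∸ r) ⟩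
      sumFrom f a ((r ∸ a) + (suc k ∸ r)) ≡⟨ cong (sumFrom f a) l≡ ⟩
      sumFrom f a l                       ≡⟨ sym (proj₂ (proj₂ interval) f) ⟩
      sum (map f ρ)                       ∎
      where open ≤-Reasoning

rankAt≤length : ∀ Y pos → rankAt Y pos ≤ length Y
rankAt≤length []       pos = z≤n
rankAt≤length (y ∷ ys) pos with pos ≤ᵇ y
... | true  = s≤s z≤n
... | false = s≤s (rankAt≤length ys (pos ∸ y))

rankAt-prefix : ∀ Y pos → 1 ≤ pos → pos ≤ sum Y → Σ ℕ λ i → rankAt Y pos ≡ suc i × sum (take i Y) < pos
rankAt-prefix []       pos 1≤pos pos≤0 = ⊥-elim (<⇒≱ 1≤pos pos≤0)
rankAt-prefix (y ∷ ys) pos 1≤pos pos≤ with pos ≤ᵇ y in pos≤ᵇy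
... | true  = 0 , refl , 1≤pos
... | false =
  let i , rank≡ , before = rankAt-prefix ys (pos ∸ y) (m<n⇒0<n∸m y<pos) (m≤n+o⇒m∸n≤o pos y pos≤)
  in suc i , cong suc rank≡ , subst (y + sum (take i ys) <_) (m+[n∸m]≡n (<⇒≤ y<pos)) (+-monoʳ-< y before)
  where
    y<pos : y < pos
    y<pos = ≰⇒> (λ pos≤y → subst T pos≤ᵇy (≤⇒≤ᵇ pos≤y))

rank-suffix-≥ : ∀ N m' Y → 1 ≤ N → N ≤ m' → sum Y ≡ m' →
                N ≤ sumFrom (at Y) (rank N m' Y) (suc (length Y) ∸ rank N m' Y)
rank-suffix-≥ N m' Y 1≤N N≤m' ΣY≡m' =
  let i , rank≡ , before = rankAt-prefix Y (suc (m' ∸ N)) (s≤s z≤n) pos≤ in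
  subst (λ r → N ≤ sumFrom (at Y) r (suc (length Y) ∸ r)) (sym rank≡)
        (subst (N ≤_) (sym (sumFrom-at≡sum-drop Y i)) (N≤suffix i (≤-pred before)))
  where
    pos≤ : suc (m' ∸ N) ≤ sum Y
    pos≤ = subst (suc (m' ∸ N) ≤_) (trans (m+[n∸m]≡n N≤m') (sym ΣY≡m')) (m<n+m (m' ∸ N) 1≤N)
    N≤suffix : ∀ i → sum (take i Y) ≤ m' ∸ N → N ≤ sum (drop i Y)
    N≤suffix i before = +-cancelʳ-≤ (m' ∸ N) N (sum (drop i Y)) (begin
      N + (m' ∸ N)                    ≡⟨ m+[n∸m]≡n N≤m' ⟩
      m'                              ≡⟨ sym ΣY≡m' ⟩
      sum Y                           ≡⟨ cong sum (sym (take++drop≡id i Y)) ⟩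
      sum (take i Y ++ drop i Y)      ≡⟨ sum-++ (take i Y) (drop i Y) ⟩
      sum (take i Y) + sum (drop i Y) ≤⟨ +-monoˡ-≤ (sum (drop i Y)) before ⟩
      (m' ∸ N) + sum (drop i Y)       ≡⟨ +-comm (m' ∸ N) _ ⟩
      sum (drop i Y) + (m' ∸ N)       ∎)
      where open ≤-Reasoning

appearsBefore⇒take-expand-≡ : ∀ X X′ Y π s N m' → N ≤ m' → sum Y ≡ m' → Connected π → length π ≤ length s →
                              AppearsBefore (rank N m' Y) (suc (length Y)) π →
                              take (length Y) X ≡ Y → take (length Y) X′ ≡ Y →
                              take N (expand X π s) ≡ take N (expand X′ π s)
appearsBefore⇒take-expand-≡ X X′ Y π s zero    m' _ _ _ _ _ _ _ = refl
appearsBefore⇒take-expand-≡ X X′ Y π s (suc N) m' N≤m' ΣY≡m' conn |π|≤|s| before XY X′Y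
  with prefix-before-suc-covers π (rank (suc N) m' Y) (length Y) conn (rankAt≤length Y _) before
... | t , ρ≤k , covers =
  subst (λ π′ → take (suc N) (expand X π′ s) ≡ take (suc N) (expand X′ π′ s)) (take++drop≡id t π)
        (take-expand-++-cong X X′ ρ (drop t π) s (suc N) (All.map X≡X′ ρ≤k) N≤ |ρ|≤|s|)
  where
    k = length Y
    r = rank (suc N) m' Y
    ρ = take t π
    Y≡ : ∀ {Z} → take k Z ≡ Y → ∀ {q} → q ≤ k → at Y q ≡ at Z q
    Y≡ {Z} ZY {q} q≤k = trans (cong (λ W → at W q) (sym ZY)) (at-take k Z q≤k)
    X≡X′ : ∀ {q} → q ≤ k → at X q ≡ at X′ q
    X≡X′ q≤k = trans (sym (Y≡ XY q≤k)) (Y≡ X′Y q≤k)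
    |ρ|≤|s| : length ρ ≤ length s
    |ρ|≤|s| = ≤-trans (≤-reflexive (length-take t π)) (≤-trans (m⊓n≤n t _) |π|≤|s|)
    N≤ : suc N ≤ sum (map (at X) ρ)
    N≤ = begin
      suc N                        ≤⟨ rank-suffix-≥ (suc N) m' Y (s≤s z≤n) N≤m' ΣY≡m' ⟩
      sumFrom (at Y) r (suc k ∸ r) ≤⟨ covers (at Y) ⟩
      sum (map (at Y) ρ)           ≡⟨ cong sum (map-cong-local (All.map (Y≡ XY) ρ≤k)) ⟩
      sum (map (at X) ρ)           ∎
      where open ≤-Reasoning

InSY-cases : ∀ {p k} (𝒮 : Search p k → Set) N m m' Y S → N ≤ m' → InSY 𝒮 N m m' Y S →
             (m' ≡ m) ⊎ AppearsBefore (rank N m' Y) (suc (length Y)) (π S)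
InSY-cases 𝒮 N m m' Y S N≤m' S∈ with suc m' ≤ᵇ N in m'<ᵇN
... | true = ⊥-elim (<⇒≱ (≤ᵇ⇒≤ (suc m') N (subst T (sym m'<ᵇN) tt)) N≤m')
... | false with m' ≡ᵇ m in m'≡ᵇm
...   | true  = inj₁ (≡ᵇ⇒≡ m' m (subst T (sym m'≡ᵇm) tt))
...   | false = inj₂ (proj₂ S∈)

positive-sum-zero : ∀ {D} → All (1 ≤_) D → sum D ≡ 0 → D ≡ []
positive-sum-zero []            _  = refl
positive-sum-zero (s≤s _ ∷ _) ()

take-≡-sum-≡⇒≡ : ∀ X Y → All (1 ≤_) X → take (length Y) X ≡ Y → sum X ≡ sum Y → X ≡ Y
take-≡-sum-≡⇒≡ X Y X>0 XY ΣX≡ΣY = begin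
  X                    ≡⟨ sym (take++drop≡id k X) ⟩
  take k X ++ drop k X ≡⟨ cong₂ _++_ XY rest≡[] ⟩
  Y ++ []              ≡⟨ ++-identityʳ Y ⟩
  Y                    ∎
  where
    open ≡-Reasoning
    k = length Y
    rest≡[] : drop k X ≡ []
    rest≡[] = positive-sum-zero (drop⁺ k X>0) (+-cancelˡ-≡ (sum Y) _ 0 (begin
      sum Y + sum (drop k X)          ≡⟨ cong (λ Z → sum Z + sum (drop k X)) (sym XY) ⟩
      sum (take k X) + sum (drop k X) ≡⟨ sym (sum-++ (take k X) (drop k X)) ⟩
      sum (take k X ++ drop k X)      ≡⟨ cong sum (take++drop≡id k X) ⟩
      sum X                           ≡⟨ ΣX≡ΣY ⟩
      sum Y                           ≡⟨ sym (+-identityʳ (sum Y)) ⟩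
      sum Y + 0                       ∎))

lemma3 : (σ n cσ k p m : ℕ) → 2 ≤ σ → 1 ≤ n →
    m < p * bigN σ n cσ →
    (𝒮 : Search p k → Set) →
    (m' : ℕ) (Y : List ℕ) → m' ≤ m → bigN σ n cσ ≤ m' →
    IsPartition m' Y → Bounded (bigN σ n cσ) Y →
    (S : Search p k) → InSY 𝒮 (bigN σ n cσ) m m' Y S →
    (X X′ : List ℕ) →
    IsPartition m X → length X ≡ p → Bounded (bigN σ n cσ) X → take (length Y) X ≡ Y →
    IsPartition m X′ → length X′ ≡ p → Bounded (bigN σ n cσ) X′ → take (length Y) X′ ≡ Y →
    {a ℓ : Level} (R : CommutativeSemiring a ℓ) (w : ℕ → CommutativeSemiring.Carrier R) →
    CommutativeSemiring._≈_ R (strings′ R w S X σ (bigN σ n cσ)) (strings′ R w S X′ σ (bigN σ n cσ))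
lemma3 σ n cσ k p m _ _ _ 𝒮 m' Y _ N≤m' (_ , ΣY≡m') _ S S∈𝒮Y X X′ (X>0 , ΣX≡m) _ _ XY (X′>0 , ΣX′≡m) _ _ X′Y R w =
  CommutativeSemiring.reflexive R (cases (InSY-cases 𝒮 N m m' Y S N≤m' S∈𝒮Y))
  where
    N = bigN σ n cσ
    |π|≤ : ∀ s → length s ≡ p → length (π S) ≤ length s
    |π|≤ s |s|≡p = ≤-reflexive (trans (proj₁ (π-perm S)) (sym |s|≡p))
    cases : (m' ≡ m) ⊎ AppearsBefore (rank N m' Y) (suc (length Y)) (π S) →
            strings′ R w S X σ N ≡ strings′ R w S X′ σ N
    cases (inj₁ m'≡m) = cong (λ Z → strings′ R w S Z σ N)
      (trans (take-≡-sum-≡⇒≡ X Y X>0 XY (trans ΣX≡m (sym (trans ΣY≡m' m'≡m))))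
        (sym (take-≡-sum-≡⇒≡ X′ Y X′>0 X′Y (trans ΣX′≡m (sym (trans ΣY≡m' m'≡m))))))
    cases (inj₂ before) = strings′-cong R w S X X′ σ N
      (appearsBefore⇒take-expand-≡ X X′ Y (π S) (L S) N m' N≤m' ΣY≡m' (π-conn S) (|π|≤ (L S) (L-len S)) before XY X′Y)
      (appearsBefore⇒take-expand-≡ X X′ Y (π S) (U S) N m' N≤m' ΣY≡m' (π-conn S) (|π|≤ (U S) (U-len S)) before XY X′Y)
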